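{- Let $X=MD(G,S_0,S_1,T_0,T_1)$ be max-$\lambda$ but not super-$\lambda$, and let $A$ be a $\lambda$-superatom of $X$. Then the subdigraph $Y=X[A]$ induced by $A$ is weakly connected.
   Context: $G$ is a finite group with identity $1_G$, $S_0,S_1\subseteq G\setminus\{1_G\}$, $T_0,T_1\subseteq G$. The mixed Cayley digraph $X=MD(G,S_0,S_1,T_0,T_1)$ has vertex set $G\times\{0,1\}$ and arcs $((g,i),(sg,i))$ for $g\in G$, $s\in S_i$, $i=0,1$; $((g,0),(tg,1))$ for $g\in G$, $t\in T_0$; and $((tg,1),(g,0))$ for $g\in G$, $t\in T_1$. $\delta(X)$ is the minimum over all vertices of all in-degrees and out-degrees; $\lambda(X)$ is the arc-connectivity (minimum number of arcs whose removal leaves a non-strongly-connected digraph). For $A\subseteq V(X)$, $\omega^+(A)$ (resp. $\omega^-(A)$) is the set of arcs from $A$ to $V(X)\setminus A$ (resp. from $V(X)\setminus A$ to $A$). A proper nonempty $A$ is a positive (resp. negative) arc fragment if $|\omega^+(A)|=\lambda(X)$ (resp. $|\omega^-(A)|=\lambda(X)$); an arc fragment is either of these. A $\lambda$-superatom is an arc fragment with at least two vertices of least possible cardinality among arc fragments with at least two vertices. $X$ is max-$\lambda$ if $\lambda(X)=\delta(X)$, and super-$\lambda$ if every minimum cut (a set $\omega^+(A)$, $A$ proper nonempty, of cardinality $\lambda(X)$) is the set of all inarcs of some vertex or the set of all outarcs of some vertex. A digraph is weakly connected if any two vertices are joined by a sequence of distinct vertices in which consecutive vertices are joined by an arc in some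 direction. -}

module Defs where

open import Data.Nat using (ℕ; zero; suc; _≤_; _<_)
open import Data.Fin using (Fin; zero; suc)
open import Data.Fin.Subset using (Subset; _∉_)
open import Data.Vec using (lookup)
open import Data.Bool using (Bool; true; false; _∧_; not)
open import Data.List using (List; []; _∷_; cartesianProduct; allFin)
open import Data.List.Relation.Unary.Unique.Propositional using (Unique)
open import Data.Product using (_×_; _,_; Σ; ∃)
open import Data.Sum using (_⊎_)
open import Relation.Nullary using (¬_)
open import Relation.Binary.PropositionalEquality using (_≡_)
open import Algebra.Structures using (IsGroup)

record MixedCayley (n : ℕ) : Set where
  field
    _∙_     : Fin n → Fin n → Fin n
    ε       : Fin n
    _⁻¹     : Fin n → Fin n
    isGroup : IsGroup _≡_ _∙_ ε _⁻¹
    S₀ S₁ T₀ T₁ : Subset n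
    ε∉S₀    : ε ∉ S₀
    ε∉S₁    : ε ∉ S₁

Vertex : ℕ → Set
Vertex n = Fin n × Fin 2

VSet : ℕ → Set
VSet n = Vertex n → Bool

ArcSet : ℕ → Set
ArcSet n = Vertex n → Vertex n → Bool

-- the arc relation of X = MD(G,S₀,S₁,T₀,T₁):
--   (g,i) → (s g, i) for s ∈ Sᵢ ; (g,0) → (t g,1) for t ∈ T₀ ; (t g,1) → (g,0) for t ∈ T₁
arc : ∀ {n} → MixedCayley n → ArcSet n
arc X (g , zero)     (h , zero)     = lookup S₀ (h ∙ (g ⁻¹)) where open MixedCayley X
arc X (g , zero)     (h , suc zero) = lookup T₀ (h ∙ (g ⁻¹)) where open MixedCayley X
arc X (g , suc zero) (h , zero)     = lookup T₁ (g ∙ (h ⁻¹)) where open MixedCayley X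
arc X (g , suc zero) (h , suc zero) = lookup S₁ (h ∙ (g ⁻¹)) where open MixedCayley X

allV : ∀ n → List (Vertex n)
allV n = cartesianProduct (allFin n) (allFin 2)

countTrue : {A : Set} → (A → Bool) → List A → ℕ
countTrue p []       = zero
countTrue p (x ∷ xs) with p x
... | true  = suc (countTrue p xs)
... | false = countTrue p xs

size : ∀ {n} → VSet n → ℕ
size {n} A = countTrue A (allV n)

arcCount : ∀ {n} → ArcSet n → ℕ
arcCount {n} F = countTrue (λ { (u , v) → F u v }) (cartesianProduct (allV n) (allV n))

outdeg indeg : ∀ {n} → MixedCayley n → Vertex n → ℕ
outdeg {n} X v = countTrue (λ u → arc X v u) (allV n)
indeg  {n} X v = countTrue (λ u → arc X u v) (allV n)

data Reach {n : ℕ} (R : ArcSet n) : Vertex n → Vertex n → Set where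
  here : ∀ {u} → Reach R u u
  step : ∀ {u w v} → R u w ≡ true → Reach R w v → Reach R u v

StronglyConnected : ∀ {n} → ArcSet n → Set
StronglyConnected R = ∀ u v → Reach R u v

removeArcs : ∀ {n} → MixedCayley n → ArcSet n → ArcSet n
removeArcs X F u v = arc X u v ∧ not (F u v)

SubsetOfArcs : ∀ {n} → MixedCayley n → ArcSet n → Set
SubsetOfArcs X F = ∀ u v → F u v ≡ true → arc X u v ≡ true

IsArcConnectivity : ∀ {n} → MixedCayley n → ℕ → Set
IsArcConnectivity X k =
  (Σ (ArcSet _) λ F → SubsetOfArcs X F × arcCount F ≡ k × ¬ StronglyConnected (removeArcs X F))
  × (∀ F → SubsetOfArcs X F → arcCount F < k → StronglyConnected (removeArcs X F))

IsMinDegree : ∀ {n} → MixedCayley n → ℕ → Set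
IsMinDegree X d =
  (∀ v → d ≤ outdeg X v × d ≤ indeg X v)
  × ∃ (λ v → outdeg X v ≡ d ⊎ indeg X v ≡ d)

ω⁺ ω⁻ : ∀ {n} → MixedCayley n → VSet n → ArcSet n
ω⁺ X A u v = A u ∧ not (A v) ∧ arc X u v
ω⁻ X A u v = not (A u) ∧ A v ∧ arc X u v

ProperNonempty : ∀ {n} → VSet n → Set
ProperNonempty A = ∃ (λ v → A v ≡ true) × ∃ (λ v → A v ≡ false)

IsArcFragment : ∀ {n} → MixedCayley n → ℕ → VSet n → Set
IsArcFragment X k A =
  ProperNonempty A × (arcCount (ω⁺ X A) ≡ k ⊎ arcCount (ω⁻ X A) ≡ k)

IsSuperatom : ∀ {n} → MixedCayley n → ℕ → VSet n → Set
IsSuperatom X k A =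
  IsArcFragment X k A × 2 ≤ size A
  × (∀ B → IsArcFragment X k B → 2 ≤ size B → size A ≤ size B)

IsAllInarcsOf : ∀ {n} → MixedCayley n → ArcSet n → Vertex n → Set
IsAllInarcsOf X F x =
  ∀ u v → (F u v ≡ true → v ≡ x × arc X u v ≡ true) × (v ≡ x → arc X u v ≡ true → F u v ≡ true)

IsAllOutarcsOf : ∀ {n} → MixedCayley n → ArcSet n → Vertex n → Set
IsAllOutarcsOf X F x =
  ∀ u v → (F u v ≡ true → u ≡ x × arc X u v ≡ true) × (u ≡ x → arc X u v ≡ true → F u v ≡ true)

SuperLambda : ∀ {n} → MixedCayley n → ℕ → Set
SuperLambda X k =
  ∀ A → ProperNonempty A → arcCount (ω⁺ X A) ≡ k →
  ∃ (λ x → IsAllInarcsOf X (ω⁺ X A) x ⊎ IsAllOutarcsOf X (ω⁺ X A) x)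

data JoinIn {n : ℕ} (X : MixedCayley n) (A : VSet n) : Vertex n → Vertex n → List (Vertex n) → Set where
  one  : ∀ {u} → A u ≡ true → JoinIn X A u u (u ∷ [])
  cons : ∀ {u w v xs} → A u ≡ true → (arc X u w ≡ true ⊎ arc X w u ≡ true) →
         JoinIn X A w v xs → JoinIn X A u v (u ∷ xs)

WeaklyConnectedInduced : ∀ {n} → MixedCayley n → VSet n → Set
WeaklyConnectedInduced {n} X A =
  ∀ u v → A u ≡ true → A v ≡ true →
  Σ (List (Vertex n)) λ xs → JoinIn X A u v xs × Unique xs

-- Let C be the set of vertices joined to a fixed v ∈ A inside X[A], and D = A ∖ C.
-- No arc of X runs between C and D, so ω⁺(C) and ω⁺(D) are disjoint parts of ω⁺(A)
-- (likewise for ω⁻). If D were nonempty, C and D would both be proper nonempty sets,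
-- each with at least λ outgoing and λ incoming arcs, so an arc fragment A would give
-- 2λ ≤ λ. This is impossible because λ > 0: were λ = δ = 0, some vertex would have
-- no outarcs (or no inarcs), and every minimum cut, being empty, would be the set of
-- all of them, making X super-λ.
module Submission where

open import Defs
open import Data.Nat using (ℕ)
open import Relation.Nullary using (¬_)
open import Relation.Binary.PropositionalEquality using (_≡_)

open import Data.Bool using (Bool; true; false; _∧_; _∨_; not)
open import Data.Bool.Properties using (not-injective; ∨-zeroʳ) renaming (_≟_ to _≟ᵇ_)
open import Data.Empty using (⊥; ⊥-elim)
open import Data.Fin using () renaming (_≟_ to _≟ᶠ_)
open import Data.List using (List; []; _∷_; length; cartesianProduct)
open import Data.List.Membership.Propositional using (_∈_; lose)
open import Data.List.Membership.Propositional.Properties using (∈-cartesianProduct⁺; ∈-allFin)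
import Data.List.Membership.DecPropositional as DecMembership
open import Data.List.Relation.Unary.All using ([])
open import Data.List.Relation.Unary.All.Properties using (¬Any⇒All¬)
open import Data.List.Relation.Unary.Any using (here; there; any?; satisfied)
open import Data.List.Relation.Unary.AllPairs using ([]; _∷_)
open import Data.List.Relation.Unary.Unique.Propositional using (Unique)
open import Data.Nat using (zero; suc; _+_; _≤_; _<_; _≤?_; z≤n; s≤s)
open import Data.Nat.Properties
open import Data.Product using (_×_; _,_; Σ; ∃; ∃₂; proj₁; proj₂)
open import Data.Product.Properties using (≡-dec)
open import Data.Sum using (_⊎_; inj₁; inj₂; [_,_]) renaming (swap to ⊎-swap)
open import Relation.Binary.Definitions using (Decidable; DecidableEquality)
open import Relation.Binary.PropositionalEquality using (_≢_; refl; sym; trans; cong; subst)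
open import Relation.Nullary using (does; yes; no; _×-dec_; _⊎-dec_)

∧-not-true : ∀ a b → a ∧ not b ≡ true → a ≡ true × b ≡ false
∧-not-true true false refl = refl , refl

∧-not-intro : ∀ {a b} → a ≡ true → b ≡ false → a ∧ not b ≡ true
∧-not-intro refl refl = refl

∧-not-∧-true : ∀ a b c → a ∧ not b ∧ c ≡ true → a ≡ true × b ≡ false × c ≡ true
∧-not-∧-true true false true refl = refl , refl , refl

∧-not-∧-intro : ∀ {a b c} → a ≡ true → b ≡ false → c ≡ true → a ∧ not b ∧ c ≡ true
∧-not-∧-intro refl refl refl = refl

not-∧-∧-true : ∀ a b c → not a ∧ b ∧ c ≡ true → a ≡ false × b ≡ true × c ≡ true
not-∧-∧-true false true true refl = refl , refl , refl

not-∧-∧-intro : ∀ {a b c} → a ≡ false → b ≡ true → c ≡ true → not a ∧ b ∧ c ≡ true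
not-∧-∧-intro refl refl refl = refl

≡true⇒≢false : ∀ {b} → b ≡ true → b ≢ false
≡true⇒≢false refl ()

m+m≤m⇒m≡0 : ∀ {m} → m + m ≤ m → m ≡ 0
m+m≤m⇒m≡0 {m} m+m≤m =
  n≤0⇒n≡0 (+-cancelˡ-≤ m m 0 (≤-trans m+m≤m (≤-reflexive (sym (+-identityʳ m)))))

module _ {V : Set} where

  countTrue≤length : ∀ (p : V → Bool) xs → countTrue p xs ≤ length xs
  countTrue≤length p []       = z≤n
  countTrue≤length p (x ∷ xs) with p x
  ... | true  = s≤s (countTrue≤length p xs)
  ... | false = m≤n⇒m≤1+n (countTrue≤length p xs)

  countTrue-pos : ∀ (p : V → Bool) {x xs} → x ∈ xs → p x ≡ true → 0 < countTrue p xs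
  countTrue-pos p (here refl) px rewrite px = s≤s z≤n
  countTrue-pos p (there {x = y} x∈xs) px with p y
  ... | true  = s≤s z≤n
  ... | false = countTrue-pos p x∈xs px

  countTrue-disjoint-+ : ∀ (p q r : V → Bool) →
    (∀ x → p x ≡ true → r x ≡ true) → (∀ x → q x ≡ true → r x ≡ true) →
    (∀ x → p x ≡ true → q x ≡ true → ⊥) →
    ∀ xs → countTrue p xs + countTrue q xs ≤ countTrue r xs
  countTrue-disjoint-+ p q r p⊆r q⊆r disjoint [] = z≤n
  countTrue-disjoint-+ p q r p⊆r q⊆r disjoint (x ∷ xs)
    with p x in px | q x in qx | r x in rx | countTrue-disjoint-+ p q r p⊆r q⊆r disjoint xs
  ... | true  | true  | _     | _  = ⊥-elim (disjoint x px qx)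
  ... | true  | false | true  | ih = s≤s ih
  ... | true  | false | false | _  = ⊥-elim (≡true⇒≢false (p⊆r x px) rx)
  ... | false | true  | true  | ih = ≤-trans (≤-reflexive (+-suc _ _)) (s≤s ih)
  ... | false | true  | false | _  = ⊥-elim (≡true⇒≢false (q⊆r x qx) rx)
  ... | false | false | true  | ih = m≤n⇒m≤1+n ih
  ... | false | false | false | ih = ih

module _ {V : Set} (_≟_ : DecidableEquality V) {vs : List V} (complete : ∀ x → x ∈ vs)
         {_~_ : V → V → Set} (_~?_ : Decidable _~_) where

  ClosedSubset : (V → Set) → V → Set
  ClosedSubset P v = Σ (V → Bool) λ C → C v ≡ true × (∀ {x} → C x ≡ true → P x)
                                       × (∀ x y → C x ≡ true → x ~ y → C y ≡ true)

  -- The set grows by one vertex per step, so fuel exceeding length vs suffices.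
  closure : (P : V → Set) → (∀ {x y} → P x → x ~ y → P y) → ∀ {v} → P v → ClosedSubset P v
  closure P P-step {v} Pv = grow (suc (length vs)) (λ x → does (x ≟ v))
                                 (≟-refl v) (λ x≟v → subst P (sym (≟-sound x≟v)) Pv)
                                 (≤-trans (n<1+n _) (m≤n+m _ _))
    where
    ≟-sound : ∀ {x y} → does (x ≟ y) ≡ true → x ≡ y
    ≟-sound {x} {y} h with x ≟ y
    ... | yes x≡y = x≡y

    ≟-refl : ∀ x → does (x ≟ x) ≡ true
    ≟-refl x with x ≟ x
    ... | yes _  = refl
    ... | no x≢x = ⊥-elim (x≢x refl)

    grow : ∀ k (C : V → Bool) → C v ≡ true → (∀ {x} → C x ≡ true → P x) →
           length vs < countTrue C vs + k → ClosedSubset P v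
    grow zero C Cv C⊆P room =
      ⊥-elim (<⇒≱ (subst (length vs <_) (+-identityʳ _) room) (countTrue≤length C vs))
    grow (suc k) C Cv C⊆P room
      with any? (λ { (x , y) → (C x ≟ᵇ true) ×-dec (x ~? y) ×-dec (C y ≟ᵇ false) })
                (cartesianProduct vs vs)
    ... | no noExit = C , Cv , C⊆P , closed
      where
      closed : ∀ x y → C x ≡ true → x ~ y → C y ≡ true
      closed x y Cx x~y with C y in Cy
      ... | true  = refl
      ... | false = ⊥-elim (noExit (lose (∈-cartesianProduct⁺ (complete x) (complete y))
                                         (Cx , x~y , Cy)))
    ... | yes exit with satisfied exit
    ... | (x , y) , Cx , x~y , Cy = grow k C′ (cong (_∨ does (v ≟ y)) Cv) C′⊆P room′
      where
      C′ : V → Bool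
      C′ z = C z ∨ does (z ≟ y)

      C′⊆P : ∀ {z} → C′ z ≡ true → P z
      C′⊆P {z} h with C z in Cz
      ... | true  = C⊆P Cz
      ... | false = subst P (sym (≟-sound h)) (P-step (C⊆P Cx) x~y)

      bigger : countTrue C vs < countTrue C′ vs
      bigger = <-≤-trans
        (m<m+n _ (countTrue-pos (λ z → does (z ≟ y)) (complete y) (≟-refl y)))
        (countTrue-disjoint-+ C (λ z → does (z ≟ y)) C′
          (λ z Cz → cong (_∨ does (z ≟ y)) Cz)
          (λ z z≟y → trans (cong (C z ∨_) z≟y) (∨-zeroʳ (C z)))
          (λ z Cz z≟y → ≡true⇒≢false (subst (λ w → C w ≡ true) (≟-sound z≟y) Cz) Cy)
          vs)

      room′ : length vs < countTrue C′ vs + k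
      room′ = <-≤-trans room (≤-trans (≤-reflexive (+-suc _ k)) (+-monoˡ-≤ k bigger))

exit-arc : ∀ {n} {R : ArcSet n} (B : VSet n) {s t} → Reach R s t → B s ≡ true → B t ≡ false →
           ∃₂ λ a b → R a b ≡ true × B a ≡ true × B b ≡ false
exit-arc B here Bs Bt = ⊥-elim (≡true⇒≢false Bs Bt)
exit-arc B (step {w = w} Rsw w↝t) Bs Bt with B w in Bw
... | true  = exit-arc B w↝t Bw Bt
... | false = _ , _ , Rsw , Bs , Bw

_≟ⱽ_ : ∀ {n} → DecidableEquality (Vertex n)
_≟ⱽ_ = ≡-dec _≟ᶠ_ _≟ᶠ_

∈allV : ∀ {n} (x : Vertex n) → x ∈ allV n
∈allV (g , i) = ∈-cartesianProduct⁺ (∈-allFin g) (∈-allFin i)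

module _ {n} (X : MixedCayley n) where

  Adj : Vertex n → Vertex n → Set
  Adj x y = arc X x y ≡ true ⊎ arc X y x ≡ true

  _⊆_ : VSet n → VSet n → Set
  C ⊆ A = ∀ {x} → C x ≡ true → A x ≡ true

  ClosedIn : VSet n → VSet n → Set
  ClosedIn A C = ∀ x y → C x ≡ true → A y ≡ true → Adj x y → C y ≡ true

  _∖_ : VSet n → VSet n → VSet n
  (A ∖ C) z = A z ∧ not (C z)

  ω⁺-true : ∀ B u v → ω⁺ X B u v ≡ true → B u ≡ true × B v ≡ false × arc X u v ≡ true
  ω⁺-true B u v = ∧-not-∧-true (B u) (B v) (arc X u v)

  ω⁻-true : ∀ B u v → ω⁻ X B u v ≡ true → B u ≡ false × B v ≡ true × arc X u v ≡ true
  ω⁻-true B u v = not-∧-∧-true (B u) (B v) (arc X u v)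

  ∖-true : ∀ A C x → (A ∖ C) x ≡ true → A x ≡ true × C x ≡ false
  ∖-true A C x = ∧-not-true (A x) (C x)

  arcCount-pos : ∀ (F : ArcSet n) {u v} → F u v ≡ true → 0 < arcCount F
  arcCount-pos F {u} {v} = countTrue-pos _ (∈-cartesianProduct⁺ (∈allV u) (∈allV v))

  arcCount-disjoint-+ : ∀ (F G H : ArcSet n) →
    (∀ u v → F u v ≡ true → H u v ≡ true) → (∀ u v → G u v ≡ true → H u v ≡ true) →
    (∀ u v → F u v ≡ true → G u v ≡ true → ⊥) →
    arcCount F + arcCount G ≤ arcCount H
  arcCount-disjoint-+ F G H F⊆H G⊆H disjoint =
    countTrue-disjoint-+ _ _ _ (λ { (u , v) → F⊆H u v }) (λ { (u , v) → G⊆H u v })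
                               (λ { (u , v) → disjoint u v }) (cartesianProduct (allV n) (allV n))

  minDegree-zero⇒superLambda : IsMinDegree X 0 → SuperLambda X 0
  minDegree-zero⇒superLambda (_ , x , degree0) B _ noCut = x , [ noOutarcs , noInarcs ] degree0
    where
    emptyCut : ∀ {u v} → ω⁺ X B u v ≡ true → ⊥
    emptyCut h = n>0⇒n≢0 (arcCount-pos (ω⁺ X B) h) noCut

    noOutarcs : outdeg X x ≡ 0 → IsAllInarcsOf X (ω⁺ X B) x ⊎ IsAllOutarcsOf X (ω⁺ X B) x
    noOutarcs out0 = inj₂ λ u v → (λ h → ⊥-elim (emptyCut h)) , λ { refl a →
      ⊥-elim (n>0⇒n≢0 (countTrue-pos (arc X x) (∈allV v) a) out0) }

    noInarcs : indeg X x ≡ 0 → IsAllInarcsOf X (ω⁺ X B) x ⊎ IsAllOutarcsOf X (ω⁺ X B) x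
    noInarcs in0 = inj₁ λ u v → (λ h → ⊥-elim (emptyCut h)) , λ { refl a →
      ⊥-elim (n>0⇒n≢0 (countTrue-pos (λ w → arc X w x) (∈allV u) a) in0) }

  module _ {k} (connectivity : IsArcConnectivity X k) where

    arcConnectivity≤cut : ∀ (B : VSet n) {s t} → B s ≡ true → B t ≡ false →
      (F : ArcSet n) → SubsetOfArcs X F →
      (∀ u v → B u ≡ true → B v ≡ false → arc X u v ≡ true → F u v ≡ true) →
      k ≤ arcCount F
    arcConnectivity≤cut B {s} {t} Bs Bt F F⊆X leaving with k ≤? arcCount F
    ... | yes k≤F = k≤F
    ... | no k≰F with exit-arc B (proj₂ connectivity F F⊆X (≰⇒> k≰F) s t) Bs Bt
    ... | a , b , kept , Ba , Bb with ∧-not-true (arc X a b) (F a b) kept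
    ... | ab , Fab = ⊥-elim (≡true⇒≢false (leaving a b Ba Bb ab) Fab)

    arcConnectivity≤ω⁺ : ∀ (B : VSet n) {s t} → B s ≡ true → B t ≡ false → k ≤ arcCount (ω⁺ X B)
    arcConnectivity≤ω⁺ B Bs Bt =
      arcConnectivity≤cut B Bs Bt (ω⁺ X B) (λ u v h → proj₂ (proj₂ (ω⁺-true B u v h)))
                                  (λ _ _ → ∧-not-∧-intro)

    arcConnectivity≤ω⁻ : ∀ (B : VSet n) {s t} → B s ≡ true → B t ≡ false → k ≤ arcCount (ω⁻ X B)
    arcConnectivity≤ω⁻ B Bs Bt =
      arcConnectivity≤cut (λ z → not (B z)) (cong not Bt) (cong not Bs) (ω⁻ X B)
        (λ u v h → proj₂ (proj₂ (ω⁻-true B u v h)))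
        (λ _ _ ¬Bu ¬¬Bv → not-∧-∧-intro (not-injective {y = false} ¬Bu)
                                        (not-injective {y = true} ¬¬Bv))

  ∖-⊆ : ∀ {A C} → (A ∖ C) ⊆ A
  ∖-⊆ {A} {C} {x} h = proj₁ (∖-true A C x h)

  module _ {A C : VSet n} (C⊆A : C ⊆ A) (closed : ClosedIn A C) where

    closed-exit : ∀ x y → C x ≡ true → C y ≡ false → Adj x y → A y ≡ false
    closed-exit x y Cx Cy xy with A y in Ay
    ... | true  = ⊥-elim (≡true⇒≢false (closed x y Cx Ay xy) Cy)
    ... | false = refl

    ∖-closed : ClosedIn A (A ∖ C)
    ∖-closed x y Dx Ay xy with ∖-true A C x Dx | C y in Cy
    ... | _  , _  | false = ∧-not-intro Ay refl
    ... | Ax , Cx | true  = ⊥-elim (≡true⇒≢false (closed y x Cy Ax (⊎-swap xy)) Cx)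

    ∖-disjoint : ∀ x → C x ≡ true → (A ∖ C) x ≡ true → ⊥
    ∖-disjoint x Cx Dx = ≡true⇒≢false Cx (proj₂ (∖-true A C x Dx))

  ω⁺-closed-⊆ : ∀ {A C} → C ⊆ A → ClosedIn A C → ∀ u v → ω⁺ X C u v ≡ true → ω⁺ X A u v ≡ true
  ω⁺-closed-⊆ {C = C} C⊆A closed u v h with ω⁺-true C u v h
  ... | Cu , Cv , uv = ∧-not-∧-intro (C⊆A Cu) (closed-exit C⊆A closed u v Cu Cv (inj₁ uv)) uv

  ω⁻-closed-⊆ : ∀ {A C} → C ⊆ A → ClosedIn A C → ∀ u v → ω⁻ X C u v ≡ true → ω⁻ X A u v ≡ true
  ω⁻-closed-⊆ {C = C} C⊆A closed u v h with ω⁻-true C u v h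
  ... | Cu , Cv , uv = not-∧-∧-intro (closed-exit C⊆A closed v u Cv Cu (inj₂ uv)) (C⊆A Cv) uv

  ω⁺-split : ∀ {A C} → C ⊆ A → ClosedIn A C →
             arcCount (ω⁺ X C) + arcCount (ω⁺ X (A ∖ C)) ≤ arcCount (ω⁺ X A)
  ω⁺-split {A} {C} C⊆A closed = arcCount-disjoint-+ _ _ _
    (ω⁺-closed-⊆ C⊆A closed) (ω⁺-closed-⊆ {A} {A ∖ C} (∖-⊆ {A} {C}) (∖-closed C⊆A closed))
    (λ u v h h′ → ∖-disjoint C⊆A closed u (proj₁ (ω⁺-true C u v h))
                                         (proj₁ (ω⁺-true (A ∖ C) u v h′)))

  ω⁻-split : ∀ {A C} → C ⊆ A → ClosedIn A C →
             arcCount (ω⁻ X C) + arcCount (ω⁻ X (A ∖ C)) ≤ arcCount (ω⁻ X A)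
  ω⁻-split {A} {C} C⊆A closed = arcCount-disjoint-+ _ _ _
    (ω⁻-closed-⊆ C⊆A closed) (ω⁻-closed-⊆ {A} {A ∖ C} (∖-⊆ {A} {C}) (∖-closed C⊆A closed))
    (λ u v h h′ → ∖-disjoint C⊆A closed v (proj₁ (proj₂ (ω⁻-true C u v h)))
                                       (proj₁ (proj₂ (ω⁻-true (A ∖ C) u v h′))))

  arcFragment-closed-⊇ : ∀ {k A C v} → IsArcConnectivity X k → k ≢ 0 → IsArcFragment X k A →
                         C ⊆ A → ClosedIn A C → C v ≡ true → A ⊆ C
  arcFragment-closed-⊇ {k} {A} {C} connectivity k≢0 ((_ , w , Aw) , cut) C⊆A closed Cv {u} Au
    with C u in Cu
  ... | true  = refl
  ... | false = ⊥-elim (k≢0 (m+m≤m⇒m≡0 ([ doubled⁺ , doubled⁻ ] cut)))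
    where
    Cw : C w ≡ false
    Cw with C w in Cw
    ... | true  = ⊥-elim (≡true⇒≢false (C⊆A Cw) Aw)
    ... | false = refl

    Du : (A ∖ C) u ≡ true
    Du = ∧-not-intro Au Cu

    Dw : (A ∖ C) w ≡ false
    Dw = cong (_∧ not (C w)) Aw

    doubled⁺ : arcCount (ω⁺ X A) ≡ k → k + k ≤ k
    doubled⁺ cut⁺ = ≤-trans
      (+-mono-≤ (arcConnectivity≤ω⁺ connectivity C Cv Cw)
                (arcConnectivity≤ω⁺ connectivity (A ∖ C) Du Dw))
      (≤-trans (ω⁺-split C⊆A closed) (≤-reflexive cut⁺))

    doubled⁻ : arcCount (ω⁻ X A) ≡ k → k + k ≤ k
    doubled⁻ cut⁻ = ≤-trans
      (+-mono-≤ (arcConnectivity≤ω⁻ connectivity C Cv Cw)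
                (arcConnectivity≤ω⁻ connectivity (A ∖ C) Du Dw))
      (≤-trans (ω⁻-split C⊆A closed) (≤-reflexive cut⁻))

  JoinIn-head : ∀ {A u v xs} → JoinIn X A u v xs → A u ≡ true
  JoinIn-head (one Au)      = Au
  JoinIn-head (cons Au _ _) = Au

  component : ∀ {A v} → A v ≡ true →
              Σ (VSet n) λ C → C v ≡ true × (∀ {x} → C x ≡ true → ∃ (JoinIn X A x v)) × ClosedIn A C
  component {A} {v} Av with closure _≟ⱽ_ ∈allV (λ x y → (A y ≟ᵇ true) ×-dec Adj? x y)
                                  (λ x → ∃ (JoinIn X A x v)) extend (_ , one Av)
    where
    Adj? : Decidable Adj
    Adj? x y = (arc X x y ≟ᵇ true) ⊎-dec (arc X y x ≟ᵇ true)

    extend : ∀ {x y} → ∃ (JoinIn X A x v) → A y ≡ true × Adj x y → ∃ (JoinIn X A y v)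
    extend (_ , x↝v) (Ay , xy) = _ , cons Ay (⊎-swap xy) x↝v
  ... | C , Cv , C↝v , closed = C , Cv , C↝v , λ x y Cx Ay xy → closed x y Cx (Ay , xy)

  module _ {A : VSet n} where
    open DecMembership {A = Vertex n} _≟ⱽ_ using (_∈?_)

    JoinIn-suffix : ∀ {u w v ys} → JoinIn X A w v ys → u ∈ ys →
                    Σ (List (Vertex n)) λ zs → JoinIn X A u v zs × (Unique ys → Unique zs)
    JoinIn-suffix (one Aw)        (here refl) = _ , one Aw , λ unique → unique
    JoinIn-suffix (cons Aw wx x↝v) (here refl) = _ , cons Aw wx x↝v , λ unique → unique
    JoinIn-suffix (cons _ _ x↝v)  (there u∈ys) with JoinIn-suffix x↝v u∈ys
    ... | zs , u↝v , keep = zs , u↝v , λ { (_ ∷ unique) → keep unique }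

    -- A repeated vertex is resolved by jumping to its later occurrence.
    JoinIn-unique : ∀ {u v xs} → JoinIn X A u v xs →
                    Σ (List (Vertex n)) λ ys → JoinIn X A u v ys × Unique ys
    JoinIn-unique (one Au) = _ , one Au , [] ∷ []
    JoinIn-unique {u} (cons Au uw w↝v) with JoinIn-unique w↝v
    ... | ys , w↝v′ , unique with u ∈? ys
    ... | no u∉ys = u ∷ ys , cons Au uw w↝v′ , ¬Any⇒All¬ ys u∉ys ∷ unique
    ... | yes u∈ys with JoinIn-suffix w↝v′ u∈ys
    ... | zs , u↝v , keep = zs , u↝v , keep unique

proposition4p1 : ∀ {n} (X : MixedCayley n) (lam δ : ℕ) →
    IsArcConnectivity X lam → IsMinDegree X δ → lam ≡ δ → ¬ SuperLambda X lam →
    (A : VSet n) → IsSuperatom X lam A → WeaklyConnectedInduced X A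
proposition4p1 X lam δ connectivity minDegree lam≡δ notSuper A (fragment , _) u v Au Av
  with component X Av
... | C , Cv , C↝v , closed = JoinIn-unique X (proj₂ (C↝v Cu))
  where
  lam≢0 : lam ≢ 0
  lam≢0 refl =
    notSuper (minDegree-zero⇒superLambda X (subst (IsMinDegree X) (sym lam≡δ) minDegree))

  Cu : C u ≡ true
  Cu = arcFragment-closed-⊇ X connectivity lam≢0 fragment
         (λ Cx → JoinIn-head X (proj₂ (C↝v Cx))) closed Cv Au
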